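{- Let $(\mathbb{L}_S,\mathbb{L}_P,\lozenge,\Diamond)$ be a normal heterogeneous $\mathcal{L}_{\mathrm{MT}}$-algebra and let $(\mathbf{SD},\mathbf{PP},\lozenge,\Diamond)$ be the Lindenbaum–Tarski heterogeneous algebra of $\mathbf{L}$. Then: (1) if $f:\mathbb{L}_P\to\mathbf{A}$ is an $\mathbf{A}$-filter, then so is $f^{ -\Diamond}$; (2) if $g:\mathbb{L}_S\to\mathbf{A}$ is an $\mathbf{A}$-filter, then so is $g^{ -\lozenge}$; (3) if $f:\mathbf{PP}\to\mathbf{A}$ is a proper $\mathbf{A}$-filter, then so is $f^{ -\Diamond}$; (4) if $g:\mathbf{SD}\to\mathbf{A}$ is a proper $\mathbf{A}$-filter, then so is $g^{ -\lozenge}$; (5) if $\pi_1,\pi_2\in\mathbf{PP}$ and $\pi_1\vee\pi_2=\top$, then $\pi_1=\top$ or $\pi_2=\top$; (6) if $\sigma_1,\sigma_2\in\mathbf{SD}$ and $\sigma_1\vee\sigma_2=\top$, then $\sigma_1=\top$ or $\sigma_2=\top$.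
   Context: $\mathbf{A}=(D,1,0,\vee,\wedge,\otimes,\to)$ is a fixed complete commutative residuated lattice which is frame-distributive and dually frame-distributive. Language: $\mathsf{SD}\ni\sigma::=\bot\mid\top\mid p\mid\sigma\wedge\sigma\mid\sigma\vee\sigma\mid\Diamond\pi$, $\mathsf{PP}\ni\pi::=\bot\mid\top\mid p\mid\pi\wedge\pi\mid\pi\vee\pi\mid\lozenge\sigma$, $p$ ranging over a countable or finite set $\mathsf{Prop}$. $\mathbf{L}$ is the smallest set of type-uniform sequents containing (for both types) $p\vdash p$, $\bot\vdash p$, $p\vdash\top$, $p\vdash p\vee q$, $q\vdash p\vee q$, $p\wedge q\vdash p$, $p\wedge q\vdash q$, $\Diamond\bot\vdash\bot$, $\Diamond(\pi_1\vee\pi_2)\vdash\Diamond\pi_1\vee\Diamond\pi_2$, $\lozenge\bot\vdash\bot$, $\lozenge(\sigma_1\vee\sigma_2)\vdash\lozenge\sigma_1\vee\lozenge\sigma_2$, closed under cut, type-respecting substitution, the $\wedge$-introduction-on-the-right and $\vee$-introduction-on-the-left rules, and monotonicity of $\Diamond$ and $\lozenge$. The Lindenbaum–Tarski heterogeneous algebra consists of the $\mathsf{SD}$-terms (resp. $\mathsf{PP}$-terms) modulo mutual $\mathbf{L}$-derivability, ordered by $[\phi]\le[\psi]$ iff $\phi\vdash\psi\in\mathbf{L}$, with the induced operations. A normal heterogeneous $\mathcal{L}_{\mathrm{MT}}$-algebra is $(\mathbb{L}_S,\mathbb{L}_P,\lozenge,\Diamond)$ with bounded lattices $\mathbb{L}_S,\mathbb{L}_P$,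 $\lozenge:\mathbb{L}_S\to\mathbb{L}_P$, $\Diamond:\mathbb{L}_P\to\mathbb{L}_S$ preserving $\bot$ and binary joins. For a bounded lattice $\mathbb{L}$, an $\mathbf{A}$-filter is $f:\mathbb{L}\to\mathbf{A}$ with $f(\top)=1$ and $f(a\wedge b)=f(a)\wedge f(b)$; it is proper if also $f(\bot)=0$. For $k:\mathbb{L}_P\to\mathbf{A}$ and $h:\mathbb{L}_S\to\mathbf{A}$, $k^{ -\Diamond}(s)=\bigvee\{k(p)\mid\Diamond p\le s\}$ for $s\in\mathbb{L}_S$ and $h^{ -\lozenge}(p)=\bigvee\{h(s)\mid\lozenge s\le p\}$ for $p\in\mathbb{L}_P$. -}

module Defs where

open import Level using (0ℓ)
open import Data.Product using (Σ; _×_; _,_; proj₁; proj₂)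
open import Algebra.Core using (Op₂)
open import Algebra.Structures using (IsCommutativeMonoid)
open import Relation.Binary.Core using (Rel)
open import Relation.Binary.Structures using (IsEquivalence; IsPreorder; IsPartialOrder)
open import Relation.Binary.Lattice.Structures using (IsBoundedLattice; IsLattice)
open import Relation.Binary.Lattice.Bundles using (BoundedLattice)

record CompleteCRL : Set₁ where
  infix 4 _≈_ _≤_
  infixr 6 _∨_
  infixr 7 _∧_ _⊗_
  infixr 5 _⇒_
  field
    D       : Set
    _≈_     : Rel D 0ℓ
    _≤_     : Rel D 0ℓ
    _∨_     : Op₂ D
    _∧_     : Op₂ D
    _⊗_     : Op₂ D
    _⇒_     : Op₂ D
    𝟏       : D
    𝟎       : D
    isBoundedLattice : IsBoundedLattice _≈_ _≤_ _∨_ _∧_ 𝟏 𝟎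
    ⊗-isCommutativeMonoid : IsCommutativeMonoid _≈_ _⊗_ 𝟏
    residuated-⇒ : ∀ {a b c} → (a ⊗ b) ≤ c → a ≤ (b ⇒ c)
    residuated-⇐ : ∀ {a b c} → a ≤ (b ⇒ c) → (a ⊗ b) ≤ c
    ⋁          : {I : Set} → (I → D) → D
    ⋁-upper    : {I : Set} (g : I → D) (i : I) → g i ≤ ⋁ g
    ⋁-least    : {I : Set} (g : I → D) (c : D) → (∀ i → g i ≤ c) → ⋁ g ≤ c
    ⋀          : {I : Set} → (I → D) → D
    ⋀-lower    : {I : Set} (g : I → D) (i : I) → ⋀ g ≤ g i
    ⋀-greatest : {I : Set} (g : I → D) (c : D) → (∀ i → c ≤ g i) → c ≤ ⋀ g

FrameDistributive : CompleteCRL → Set₁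
FrameDistributive A = ∀ {I : Set} (a : D) (g : I → D) → (a ∧ ⋁ g) ≈ ⋁ (λ i → a ∧ g i)
  where open CompleteCRL A

DuallyFrameDistributive : CompleteCRL → Set₁
DuallyFrameDistributive A = ∀ {I : Set} (a : D) (g : I → D) → (a ∨ ⋀ g) ≈ ⋀ (λ i → a ∨ g i)
  where open CompleteCRL A

-- Normal heterogeneous L_MT-algebras (L_S, L_P, ◊, ◇)
--   ◊ (lozenge) : L_S → L_P ,   ◇ (Diamond) : L_P → L_S
-- both are (setoid-)functions preserving ⊥ and binary joins.

record NormalHA : Set₁ where
  field
    LS : BoundedLattice 0ℓ 0ℓ 0ℓ
    LP : BoundedLattice 0ℓ 0ℓ 0ℓ
  module S = BoundedLattice LS
  module P = BoundedLattice LP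
  field
    ◊    : S.Carrier → P.Carrier
    ◇    : P.Carrier → S.Carrier
    ◊-cong : ∀ {x y} → x S.≈ y → ◊ x P.≈ ◊ y
    ◇-cong : ∀ {x y} → x P.≈ y → ◇ x S.≈ ◇ y
    ◊-⊥  : ◊ S.⊥ P.≈ P.⊥
    ◇-⊥  : ◇ P.⊥ S.≈ S.⊥
    ◊-∨  : ∀ x y → ◊ (x S.∨ y) P.≈ (◊ x P.∨ ◊ y)
    ◇-∨  : ∀ x y → ◇ (x P.∨ y) S.≈ (◇ x S.∨ ◇ y)

record IsAFilter (A : CompleteCRL) (L : BoundedLattice 0ℓ 0ℓ 0ℓ)
                 (f : BoundedLattice.Carrier L → CompleteCRL.D A) : Set where
  private
    module A = CompleteCRL A
    module L = BoundedLattice L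
  field
    f-cong : ∀ {x y} → x L.≈ y → f x A.≈ f y
    f-⊤    : f L.⊤ A.≈ A.𝟏
    f-∧    : ∀ x y → f (x L.∧ y) A.≈ (f x A.∧ f y)

record IsProperAFilter (A : CompleteCRL) (L : BoundedLattice 0ℓ 0ℓ 0ℓ)
                       (f : BoundedLattice.Carrier L → CompleteCRL.D A) : Set where
  field
    isAFilter : IsAFilter A L f
    f-⊥       : CompleteCRL._≈_ A (f (BoundedLattice.⊥ L)) (CompleteCRL.𝟎 A)

pre◇ : (A : CompleteCRL) (H : NormalHA) →
       (BoundedLattice.Carrier (NormalHA.LP H) → CompleteCRL.D A) →
       BoundedLattice.Carrier (NormalHA.LS H) → CompleteCRL.D A
pre◇ A H k s =
  CompleteCRL.⋁ A {Σ P.Carrier (λ p → ◇ p S.≤ s)} (λ i → k (proj₁ i))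
  where open NormalHA H

pre◊ : (A : CompleteCRL) (H : NormalHA) →
       (BoundedLattice.Carrier (NormalHA.LS H) → CompleteCRL.D A) →
       BoundedLattice.Carrier (NormalHA.LP H) → CompleteCRL.D A
pre◊ A H h p =
  CompleteCRL.⋁ A {Σ S.Carrier (λ s → ◊ s P.≤ p)} (λ i → h (proj₁ i))
  where open NormalHA H

module LT (Prop : Set) where

  infixr 6 _∨s_ _∨p_
  infixr 7 _∧s_ _∧p_
  infix 4 _⊢S_ _⊢P_

  data SD : Set
  data PP : Set

  data SD where
    ⊥s ⊤s : SD
    atS   : Prop → SD
    _∧s_ _∨s_ : SD → SD → SD
    ◇s    : PP → SD

  data PP where
    ⊥p ⊤p : PP
    atP   : Prop → PP
    _∧p_ _∨p_ : PP → PP → PP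
    ◊p    : SD → PP

  record Subst : Set where
    field
      forS : Prop → SD
      forP : Prop → PP

  subS : Subst → SD → SD
  subP : Subst → PP → PP
  subS θ ⊥s = ⊥s
  subS θ ⊤s = ⊤s
  subS θ (atS x) = Subst.forS θ x
  subS θ (a ∧s b) = subS θ a ∧s subS θ b
  subS θ (a ∨s b) = subS θ a ∨s subS θ b
  subS θ (◇s π) = ◇s (subP θ π)
  subP θ ⊥p = ⊥p
  subP θ ⊤p = ⊤p
  subP θ (atP x) = Subst.forP θ x
  subP θ (a ∧p b) = subP θ a ∧p subP θ b
  subP θ (a ∨p b) = subP θ a ∨p subP θ b
  subP θ (◊p σ) = ◊p (subS θ σ)

  data _⊢S_ : SD → SD → Set
  data _⊢P_ : PP → PP → Set

  data _⊢S_ where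
    idS  : ∀ a → a ⊢S a
    ⊥S   : ∀ a → ⊥s ⊢S a
    ⊤S   : ∀ a → a ⊢S ⊤s
    ∨₁S  : ∀ a b → a ⊢S a ∨s b
    ∨₂S  : ∀ a b → b ⊢S a ∨s b
    ∧₁S  : ∀ a b → a ∧s b ⊢S a
    ∧₂S  : ∀ a b → a ∧s b ⊢S b
    ◇⊥   : ◇s ⊥p ⊢S ⊥s
    ◇∨   : ∀ π₁ π₂ → ◇s (π₁ ∨p π₂) ⊢S ◇s π₁ ∨s ◇s π₂
    cutS : ∀ {a b c} → a ⊢S b → b ⊢S c → a ⊢S c
    substS : ∀ (θ : Subst) {a b} → a ⊢S b → subS θ a ⊢S subS θ b
    ∧RS  : ∀ {a b c} → a ⊢S b → a ⊢S c → a ⊢S b ∧s c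
    ∨LS  : ∀ {a b c} → a ⊢S c → b ⊢S c → a ∨s b ⊢S c
    monoS : ∀ {π₁ π₂} → π₁ ⊢P π₂ → ◇s π₁ ⊢S ◇s π₂

  data _⊢P_ where
    idP  : ∀ a → a ⊢P a
    ⊥P   : ∀ a → ⊥p ⊢P a
    ⊤P   : ∀ a → a ⊢P ⊤p
    ∨₁P  : ∀ a b → a ⊢P a ∨p b
    ∨₂P  : ∀ a b → b ⊢P a ∨p b
    ∧₁P  : ∀ a b → a ∧p b ⊢P a
    ∧₂P  : ∀ a b → a ∧p b ⊢P b
    ◊⊥   : ◊p ⊥s ⊢P ⊥p
    ◊∨   : ∀ σ₁ σ₂ → ◊p (σ₁ ∨s σ₂) ⊢P ◊p σ₁ ∨p ◊p σ₂
    cutP : ∀ {a b c} → a ⊢P b → b ⊢P c → a ⊢P c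
    substP : ∀ (θ : Subst) {a b} → a ⊢P b → subP θ a ⊢P subP θ b
    ∧RP  : ∀ {a b c} → a ⊢P b → a ⊢P c → a ⊢P b ∧p c
    ∨LP  : ∀ {a b c} → a ⊢P c → b ⊢P c → a ∨p b ⊢P c
    monoP : ∀ {σ₁ σ₂} → σ₁ ⊢S σ₂ → ◊p σ₁ ⊢P ◊p σ₂

  _≡S_ : SD → SD → Set
  a ≡S b = (a ⊢S b) × (b ⊢S a)

  _≡P_ : PP → PP → Set
  a ≡P b = (a ⊢P b) × (b ⊢P a)

  SDLattice : BoundedLattice 0ℓ 0ℓ 0ℓ
  SDLattice = record
    { Carrier = SD ; _≈_ = _≡S_ ; _≤_ = _⊢S_
    ; _∨_ = _∨s_ ; _∧_ = _∧s_ ; ⊤ = ⊤s ; ⊥ = ⊥s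
    ; isBoundedLattice = record
      { isLattice = record
        { isPartialOrder = record
          { isPreorder = record
            { isEquivalence = record
              { refl = λ {a} → idS a , idS a
              ; sym = λ (p , q) → q , p
              ; trans = λ (p , q) (r , s) → cutS p r , cutS s q }
            ; reflexive = proj₁
            ; trans = cutS }
          ; antisym = _,_ }
        ; supremum = λ a b → ∨₁S a b , ∨₂S a b , λ c → ∨LS
        ; infimum  = λ a b → ∧₁S a b , ∧₂S a b , λ c → ∧RS }
      ; maximum = ⊤S
      ; minimum = ⊥S } }

  PPLattice : BoundedLattice 0ℓ 0ℓ 0ℓ
  PPLattice = record
    { Carrier = PP ; _≈_ = _≡P_ ; _≤_ = _⊢P_
    ; _∨_ = _∨p_ ; _∧_ = _∧p_ ; ⊤ = ⊤p ; ⊥ = ⊥p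
    ; isBoundedLattice = record
      { isLattice = record
        { isPartialOrder = record
          { isPreorder = record
            { isEquivalence = record
              { refl = λ {a} → idP a , idP a
              ; sym = λ (p , q) → q , p
              ; trans = λ (p , q) (r , s) → cutP p r , cutP s q }
            ; reflexive = proj₁
            ; trans = cutP }
          ; antisym = _,_ }
        ; supremum = λ a b → ∨₁P a b , ∨₂P a b , λ c → ∨LP
        ; infimum  = λ a b → ∧₁P a b , ∧₂P a b , λ c → ∧RP }
      ; maximum = ⊤P
      ; minimum = ⊥P } }

  LTAlgebra : NormalHA
  LTAlgebra = record
    { LS = SDLattice ; LP = PPLattice
    ; ◊ = ◊p ; ◇ = ◇s
    ; ◊-cong = λ (p , q) → monoP p , monoP q
    ; ◇-cong = λ (p , q) → monoS p , monoS q
    ; ◊-⊥ = ◊⊥ , ⊥P (◊p ⊥s)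
    ; ◇-⊥ = ◇⊥ , ⊥S (◇s ⊥p)
    ; ◊-∨ = λ x y → ◊∨ x y , ∨LP (monoP (∨₁S x y)) (monoP (∨₂S x y))
    ; ◇-∨ = λ x y → ◇∨ x y , ∨LS (monoS (∨₁P x y)) (monoS (∨₂P x y)) }

module Submission where

-- Parts (1)–(4) are order theory.  A join-preserving map between lattices
-- is monotone, and so (dually) is a meet-preserving one; hence ◇ and every
-- A-filter are monotone.  For a filter f the map f^{-◇} is then monotone, so
-- it respects ≈ and f^{-◇}(s ∧ t) ≤ f^{-◇}(s) ∧ f^{-◇}(t).  The reverse
-- inequality uses frame distributivity of A: a meet of two joins is the join
-- of the pairwise meets f(p) ∧ f(q) = f(p ∧ q), and ◇(p ∧ q) ≤ s ∧ t.  If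
-- moreover ◇ reflects the bottom element, f^{-◇} of a proper filter is
-- proper.  Parts (2) and (4) are parts (1) and (3) for the converse algebra,
-- which swaps the two sorts and the two modalities.
--
-- Parts (3)–(6) need two facts about the Lindenbaum–Tarski algebra, proved
-- by soundness of L for two-valued semantics in which both modalities are
-- read as x ↦ μ ∧ x.  With μ = true and all atoms true, every formula is
-- either refutable (⊢ ⊥) or true; this shows that ◇ and ◊ reflect ⊥.  With
-- μ = false and all atoms false, every formula is either provable (⊤ ⊢) or
-- false; since the interpretation of ∨ is Boolean disjunction, ⊤ is
-- join-prime, which is (5) and (6).

open import Level using (0ℓ)
open import Data.Bool using (Bool; true; false; T; _∧_; _∨_)
open import Data.Bool.Properties using (T-∧; T-∨; ∧-zeroʳ; ∧-distribˡ-∨)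
open import Data.Empty using (⊥-elim)
open import Data.Nat using (ℕ)
open import Data.Product using (_×_; _,_; proj₁; proj₂)
open import Data.Sum using (_⊎_; inj₁; inj₂; [_,_]; fromInj₁)
open import Function.Base using (_∘_)
open import Function.Bundles using (_↣_; Equivalence)
open import Relation.Binary.Lattice.Bundles using (Lattice; BoundedLattice)
open import Relation.Binary.PropositionalEquality using (_≡_; refl; cong; cong₂; subst)
open import Relation.Nullary using (¬_)
import Relation.Binary.Lattice.Properties.JoinSemilattice as JoinProperties
import Relation.Binary.Lattice.Properties.MeetSemilattice as MeetProperties
import Relation.Binary.Lattice.Properties.Lattice as LatticeProperties
import Relation.Binary.Reasoning.PartialOrder as PosetReasoning

open import Defs

join-preserving⇒monotone :
  ∀ {c ℓ₁ ℓ₂ c′ ℓ₁′ ℓ₂′} (L : Lattice c ℓ₁ ℓ₂) (M : Lattice c′ ℓ₁′ ℓ₂′) →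
  (h : Lattice.Carrier L → Lattice.Carrier M) →
  (∀ {x y} → Lattice._≈_ L x y → Lattice._≈_ M (h x) (h y)) →
  (∀ x y → Lattice._≈_ M (h (Lattice._∨_ L x y)) (Lattice._∨_ M (h x) (h y))) →
  ∀ {x y} → Lattice._≤_ L x y → Lattice._≤_ M (h x) (h y)
join-preserving⇒monotone L M h h-cong h-∨ {x} {y} x≤y = begin
  h x          ≤⟨ M.x≤x∨y (h x) (h y) ⟩
  h x M.∨ h y  ≈⟨ M.Eq.sym (h-∨ x y) ⟩
  h (x L.∨ y)  ≈⟨ h-cong (JoinProperties.x≤y⇒x∨y≈y L.joinSemilattice x≤y) ⟩
  h y          ∎
  where
  module L = Lattice L
  module M = Lattice M
  open PosetReasoning M.poset

-- Dually, a congruent map preserving binary meets is monotone: it preserves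
-- joins of the order-dual lattices, and duality reverses both orders.
meet-preserving⇒monotone :
  ∀ {c ℓ₁ ℓ₂ c′ ℓ₁′ ℓ₂′} (L : Lattice c ℓ₁ ℓ₂) (M : Lattice c′ ℓ₁′ ℓ₂′) →
  (h : Lattice.Carrier L → Lattice.Carrier M) →
  (∀ {x y} → Lattice._≈_ L x y → Lattice._≈_ M (h x) (h y)) →
  (∀ x y → Lattice._≈_ M (h (Lattice._∧_ L x y)) (Lattice._∧_ M (h x) (h y))) →
  ∀ {x y} → Lattice._≤_ L x y → Lattice._≤_ M (h x) (h y)
meet-preserving⇒monotone L M h h-cong h-∧ x≤y =
  join-preserving⇒monotone (dual L) (dual M) h h-cong h-∧ x≤y
  where
  dual : ∀ {c ℓ₁ ℓ₂} → Lattice c ℓ₁ ℓ₂ → Lattice c ℓ₁ ℓ₂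
  dual K = LatticeProperties.∧-∨-lattice K

boundedLatticeOf : CompleteCRL → BoundedLattice 0ℓ 0ℓ 0ℓ
boundedLatticeOf A = record { isBoundedLattice = CompleteCRL.isBoundedLattice A }

latticeOf : CompleteCRL → Lattice 0ℓ 0ℓ 0ℓ
latticeOf A = BoundedLattice.lattice (boundedLatticeOf A)

module _ (A : CompleteCRL) (FD : FrameDistributive A) where
  open CompleteCRL A renaming (_∧_ to _⊓_)
  open Lattice (latticeOf A) using (poset; reflexive; trans)
  open MeetProperties (Lattice.meetSemilattice (latticeOf A)) using (∧-comm)
  open PosetReasoning poset

  meet-with-join-least : ∀ {I : Set} (a : D) (g : I → D) (c : D) →
    (∀ i → a ⊓ g i ≤ c) → a ⊓ ⋁ g ≤ c
  meet-with-join-least a g c bound = begin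
    a ⊓ ⋁ g              ≈⟨ FD a g ⟩
    ⋁ (λ i → a ⊓ g i)    ≤⟨ ⋁-least _ c bound ⟩
    c                    ∎

  meet-of-joins-least : ∀ {I J : Set} (g : I → D) (h : J → D) (c : D) →
    (∀ i j → g i ⊓ h j ≤ c) → ⋁ g ⊓ ⋁ h ≤ c
  meet-of-joins-least g h c bound =
    meet-with-join-least (⋁ g) h c λ j → begin
      ⋁ g ⊓ h j   ≈⟨ ∧-comm (⋁ g) (h j) ⟩
      h j ⊓ ⋁ g   ≤⟨ meet-with-join-least (h j) g c (λ i →
                       trans (reflexive (∧-comm (h j) (g i))) (bound i j)) ⟩
      c           ∎

◇ReflectsBottom : NormalHA → Set
◇ReflectsBottom H = ∀ p → ◇ p S.≤ S.⊥ → p P.≤ P.⊥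
  where open NormalHA H

-- The converse algebra exchanges the sorts and the modalities, so that
-- pre◊ A H is (definitionally) pre◇ A (converse H).
converse : NormalHA → NormalHA
converse H = record
  { LS = LP ; LP = LS ; ◊ = ◇ ; ◇ = ◊ ; ◊-cong = ◇-cong ; ◇-cong = ◊-cong
  ; ◊-⊥ = ◇-⊥ ; ◇-⊥ = ◊-⊥ ; ◊-∨ = ◇-∨ ; ◇-∨ = ◊-∨ }
  where open NormalHA H

module _ (A : CompleteCRL) (FD : FrameDistributive A) (H : NormalHA) where
  open CompleteCRL A renaming (_∧_ to _⊓_)
  open BoundedLattice (boundedLatticeOf A)
    using (module Eq; antisym; reflexive; trans; ∧-greatest; maximum; minimum)
  open NormalHA H

  ◇-monotone : ∀ {p q} → p P.≤ q → ◇ p S.≤ ◇ q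
  ◇-monotone = join-preserving⇒monotone P.lattice S.lattice ◇ ◇-cong ◇-∨

  module _ (f : P.Carrier → D) (F : IsAFilter A LP f) where
    open IsAFilter F

    filter-monotone : ∀ {p q} → p P.≤ q → f p ≤ f q
    filter-monotone = meet-preserving⇒monotone P.lattice (latticeOf A) f f-cong f-∧

    -- Enlarging s enlarges the index set {p | ◇ p ≤ s} of the join.
    pre◇-monotone : ∀ {s t} → s S.≤ t → pre◇ A H f s ≤ pre◇ A H f t
    pre◇-monotone s≤t =
      ⋁-least _ _ λ (p , ◇p≤s) → ⋁-upper _ (p , S.trans ◇p≤s s≤t)

    -- The key inequality: for ◇ p ≤ s and ◇ q ≤ t we have
    -- f p ⊓ f q ≈ f (p ∧ q) and ◇ (p ∧ q) ≤ s ∧ t.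
    pre◇-∧-≥ : ∀ s t → pre◇ A H f s ⊓ pre◇ A H f t ≤ pre◇ A H f (s S.∧ t)
    pre◇-∧-≥ s t = meet-of-joins-least A FD _ _ _ λ (p , ◇p≤s) (q , ◇q≤t) →
      trans (reflexive (Eq.sym (f-∧ p q)))
        (⋁-upper _ (p P.∧ q , S.∧-greatest
          (S.trans (◇-monotone (P.x∧y≤x p q)) ◇p≤s)
          (S.trans (◇-monotone (P.x∧y≤y p q)) ◇q≤t)))

    pre◇-isAFilter : IsAFilter A LS (pre◇ A H f)
    pre◇-isAFilter = record
      { f-cong = λ s≈t → antisym (pre◇-monotone (S.reflexive s≈t))
                                 (pre◇-monotone (S.reflexive (S.Eq.sym s≈t)))
      ; f-⊤ = antisym (maximum _)
                (trans (reflexive (Eq.sym f-⊤)) (⋁-upper _ (P.⊤ , S.maximum _)))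
      ; f-∧ = λ s t → antisym
                (∧-greatest (pre◇-monotone (S.x∧y≤x s t)) (pre◇-monotone (S.x∧y≤y s t)))
                (pre◇-∧-≥ s t)
      }

  -- Part (3) in general form: if ◇ reflects ⊥, then f^{-◇} of a proper
  -- filter f is proper, because every f p with ◇ p ≤ ⊥ is below f ⊥ = 0.
  pre◇-isProper : ◇ReflectsBottom H → (f : P.Carrier → D) →
    IsProperAFilter A LP f → IsProperAFilter A LS (pre◇ A H f)
  pre◇-isProper reflects f F = record
    { isAFilter = pre◇-isAFilter f isAFilter
    ; f-⊥ = antisym
        (⋁-least _ _ λ (p , ◇p≤⊥) → trans (filter-monotone f isAFilter (reflects p ◇p≤⊥))
                                          (reflexive f-⊥))
        (minimum _)
    }
    where open IsProperAFilter F

module BooleanEntailment where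

  ∧-elimˡ : ∀ {a b} → T (a ∧ b) → T a
  ∧-elimˡ = proj₁ ∘ Equivalence.to T-∧

  ∧-elimʳ : ∀ {a b} → T (a ∧ b) → T b
  ∧-elimʳ = proj₂ ∘ Equivalence.to T-∧

  ∧-intro : ∀ {a b c} → (T a → T b) → (T a → T c) → T a → T (b ∧ c)
  ∧-intro a⇒b a⇒c t = Equivalence.from T-∧ (a⇒b t , a⇒c t)

  ∨-introˡ : ∀ {a b} → T a → T (a ∨ b)
  ∨-introˡ = Equivalence.from T-∨ ∘ inj₁

  ∨-introʳ : ∀ {a b} → T b → T (a ∨ b)
  ∨-introʳ = Equivalence.from T-∨ ∘ inj₂

  ∨-elim : ∀ {a b c} → (T a → T c) → (T b → T c) → T (a ∨ b) → T c
  ∨-elim a⇒c b⇒c = [ a⇒c , b⇒c ] ∘ Equivalence.to T-∨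

  μ∧-monotone : ∀ μ {a b} → (T a → T b) → T (μ ∧ a) → T (μ ∧ b)
  μ∧-monotone μ a⇒b = ∧-intro ∧-elimˡ (a⇒b ∘ ∧-elimʳ)

  μ∧-false : ∀ μ → T (μ ∧ false) → T false
  μ∧-false μ = subst T (∧-zeroʳ μ)

  μ∧-∨ : ∀ μ a b → T (μ ∧ (a ∨ b)) → T ((μ ∧ a) ∨ (μ ∧ b))
  μ∧-∨ μ a b = subst T (∧-distribˡ-∨ μ a b)

module TwoValued (Prop : Set) (μ : Bool) where
  open LT Prop
  open BooleanEntailment

  record Valuation : Set where
    field
      valS : Prop → Bool
      valP : Prop → Bool
  open Valuation

  evalS : Valuation → SD → Bool
  evalP : Valuation → PP → Bool
  evalS v ⊥s       = false
  evalS v ⊤s       = true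
  evalS v (atS x)  = valS v x
  evalS v (a ∧s b) = evalS v a ∧ evalS v b
  evalS v (a ∨s b) = evalS v a ∨ evalS v b
  evalS v (◇s π)   = μ ∧ evalP v π
  evalP v ⊥p       = false
  evalP v ⊤p       = true
  evalP v (atP x)  = valP v x
  evalP v (a ∧p b) = evalP v a ∧ evalP v b
  evalP v (a ∨p b) = evalP v a ∨ evalP v b
  evalP v (◊p σ)   = μ ∧ evalS v σ

  pullback : Subst → Valuation → Valuation
  pullback θ v = record { valS = evalS v ∘ Subst.forS θ ; valP = evalP v ∘ Subst.forP θ }

  evalS-subst : ∀ θ v a → evalS v (subS θ a) ≡ evalS (pullback θ v) a
  evalP-subst : ∀ θ v a → evalP v (subP θ a) ≡ evalP (pullback θ v) a
  evalS-subst θ v ⊥s       = refl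
  evalS-subst θ v ⊤s       = refl
  evalS-subst θ v (atS x)  = refl
  evalS-subst θ v (a ∧s b) = cong₂ _∧_ (evalS-subst θ v a) (evalS-subst θ v b)
  evalS-subst θ v (a ∨s b) = cong₂ _∨_ (evalS-subst θ v a) (evalS-subst θ v b)
  evalS-subst θ v (◇s π)   = cong (μ ∧_) (evalP-subst θ v π)
  evalP-subst θ v ⊥p       = refl
  evalP-subst θ v ⊤p       = refl
  evalP-subst θ v (atP x)  = refl
  evalP-subst θ v (a ∧p b) = cong₂ _∧_ (evalP-subst θ v a) (evalP-subst θ v b)
  evalP-subst θ v (a ∨p b) = cong₂ _∨_ (evalP-subst θ v a) (evalP-subst θ v b)
  evalP-subst θ v (◊p σ)   = cong (μ ∧_) (evalS-subst θ v σ)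

  soundS : ∀ {a b} → a ⊢S b → ∀ v → T (evalS v a) → T (evalS v b)
  soundP : ∀ {a b} → a ⊢P b → ∀ v → T (evalP v a) → T (evalP v b)
  soundS (idS a)     v = λ t → t
  soundS (⊥S a)      v = λ ()
  soundS (⊤S a)      v = λ _ → _
  soundS (∨₁S a b)   v = ∨-introˡ
  soundS (∨₂S a b)   v = ∨-introʳ
  soundS (∧₁S a b)   v = ∧-elimˡ
  soundS (∧₂S a b)   v = ∧-elimʳ
  soundS ◇⊥          v = μ∧-false μ
  soundS (◇∨ π₁ π₂)  v = μ∧-∨ μ (evalP v π₁) (evalP v π₂)
  soundS (cutS d e)  v = soundS e v ∘ soundS d v
  soundS (substS θ {a} {b} d) v
    rewrite evalS-subst θ v a | evalS-subst θ v b = soundS d (pullback θ v)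
  soundS (∧RS d e)   v = ∧-intro (soundS d v) (soundS e v)
  soundS (∨LS d e)   v = ∨-elim (soundS d v) (soundS e v)
  soundS (monoS d)   v = μ∧-monotone μ (soundP d v)
  soundP (idP a)     v = λ t → t
  soundP (⊥P a)      v = λ ()
  soundP (⊤P a)      v = λ _ → _
  soundP (∨₁P a b)   v = ∨-introˡ
  soundP (∨₂P a b)   v = ∨-introʳ
  soundP (∧₁P a b)   v = ∧-elimˡ
  soundP (∧₂P a b)   v = ∧-elimʳ
  soundP ◊⊥          v = μ∧-false μ
  soundP (◊∨ σ₁ σ₂)  v = μ∧-∨ μ (evalS v σ₁) (evalS v σ₂)
  soundP (cutP d e)  v = soundP e v ∘ soundP d v
  soundP (substP θ {a} {b} d) v
    rewrite evalP-subst θ v a | evalP-subst θ v b = soundP d (pullback θ v)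
  soundP (∧RP d e)   v = ∧-intro (soundP d v) (soundP e v)
  soundP (∨LP d e)   v = ∨-elim (soundP d v) (soundP e v)
  soundP (monoP d)   v = μ∧-monotone μ (soundS d v)

module Lindenbaum (Prop : Set) where
  open LT Prop
  open BooleanEntailment

  module Identity = TwoValued Prop true

  allTrue : Identity.Valuation
  allTrue = record { valS = λ _ → true ; valP = λ _ → true }

  -- Every formula is refutable or true under allTrue: the only formulas
  -- evaluating to false are built from ⊥ by ∧, ∨ and the modalities.
  refutable-or-trueS : ∀ a → a ⊢S ⊥s ⊎ T (Identity.evalS allTrue a)
  refutable-or-trueP : ∀ a → a ⊢P ⊥p ⊎ T (Identity.evalP allTrue a)
  refutable-or-trueS ⊥s = inj₁ (idS ⊥s)
  refutable-or-trueS ⊤s = inj₂ _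
  refutable-or-trueS (atS x) = inj₂ _
  refutable-or-trueS (a ∧s b) with refutable-or-trueS a | refutable-or-trueS b
  ... | inj₁ a⊢⊥ | _        = inj₁ (cutS (∧₁S a b) a⊢⊥)
  ... | inj₂ _   | inj₁ b⊢⊥ = inj₁ (cutS (∧₂S a b) b⊢⊥)
  ... | inj₂ ta  | inj₂ tb  = inj₂ (Equivalence.from T-∧ (ta , tb))
  refutable-or-trueS (a ∨s b) with refutable-or-trueS a | refutable-or-trueS b
  ... | inj₁ a⊢⊥ | inj₁ b⊢⊥ = inj₁ (∨LS a⊢⊥ b⊢⊥)
  ... | inj₂ ta  | _        = inj₂ (∨-introˡ ta)
  ... | inj₁ _   | inj₂ tb  = inj₂ (∨-introʳ tb)
  refutable-or-trueS (◇s π) with refutable-or-trueP π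
  ... | inj₁ π⊢⊥ = inj₁ (cutS (monoS π⊢⊥) ◇⊥)
  ... | inj₂ tπ  = inj₂ tπ
  refutable-or-trueP ⊥p = inj₁ (idP ⊥p)
  refutable-or-trueP ⊤p = inj₂ _
  refutable-or-trueP (atP x) = inj₂ _
  refutable-or-trueP (a ∧p b) with refutable-or-trueP a | refutable-or-trueP b
  ... | inj₁ a⊢⊥ | _        = inj₁ (cutP (∧₁P a b) a⊢⊥)
  ... | inj₂ _   | inj₁ b⊢⊥ = inj₁ (cutP (∧₂P a b) b⊢⊥)
  ... | inj₂ ta  | inj₂ tb  = inj₂ (Equivalence.from T-∧ (ta , tb))
  refutable-or-trueP (a ∨p b) with refutable-or-trueP a | refutable-or-trueP b
  ... | inj₁ a⊢⊥ | inj₁ b⊢⊥ = inj₁ (∨LP a⊢⊥ b⊢⊥)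
  ... | inj₂ ta  | _        = inj₂ (∨-introˡ ta)
  ... | inj₁ _   | inj₂ tb  = inj₂ (∨-introʳ tb)
  refutable-or-trueP (◊p σ) with refutable-or-trueS σ
  ... | inj₁ σ⊢⊥ = inj₁ (cutP (monoP σ⊢⊥) ◊⊥)
  ... | inj₂ tσ  = inj₂ tσ

  -- If ◇ π ⊢ ⊥ then π is not true under allTrue (soundness), so π ⊢ ⊥.
  ◇-reflects-⊥ : ◇ReflectsBottom LTAlgebra
  ◇-reflects-⊥ π ◇π⊢⊥ =
    fromInj₁ (λ tπ → ⊥-elim (Identity.soundS ◇π⊢⊥ allTrue tπ)) (refutable-or-trueP π)

  ◊-reflects-⊥ : ◇ReflectsBottom (converse LTAlgebra)
  ◊-reflects-⊥ σ ◊σ⊢⊥ =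
    fromInj₁ (λ tσ → ⊥-elim (Identity.soundP ◊σ⊢⊥ allTrue tσ)) (refutable-or-trueS σ)

  module Null = TwoValued Prop false

  allFalse : Null.Valuation
  allFalse = record { valS = λ _ → false ; valP = λ _ → false }

  -- Every formula is provable or false under allFalse: the only formulas
  -- evaluating to true are built from ⊤ by ∧ and ∨.
  provable-or-falseS : ∀ a → ⊤s ⊢S a ⊎ ¬ T (Null.evalS allFalse a)
  provable-or-falseP : ∀ a → ⊤p ⊢P a ⊎ ¬ T (Null.evalP allFalse a)
  provable-or-falseS ⊥s = inj₂ λ ()
  provable-or-falseS ⊤s = inj₁ (idS ⊤s)
  provable-or-falseS (atS x) = inj₂ λ ()
  provable-or-falseS (a ∧s b) with provable-or-falseS a | provable-or-falseS b
  ... | inj₁ ⊢a | inj₁ ⊢b = inj₁ (∧RS ⊢a ⊢b)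
  ... | inj₂ fa | _       = inj₂ (fa ∘ ∧-elimˡ)
  ... | inj₁ _  | inj₂ fb = inj₂ (fb ∘ ∧-elimʳ)
  provable-or-falseS (a ∨s b) with provable-or-falseS a | provable-or-falseS b
  ... | inj₁ ⊢a | _       = inj₁ (cutS ⊢a (∨₁S a b))
  ... | inj₂ _  | inj₁ ⊢b = inj₁ (cutS ⊢b (∨₂S a b))
  ... | inj₂ fa | inj₂ fb = inj₂ (∨-elim fa fb)
  provable-or-falseS (◇s π) = inj₂ λ ()
  provable-or-falseP ⊥p = inj₂ λ ()
  provable-or-falseP ⊤p = inj₁ (idP ⊤p)
  provable-or-falseP (atP x) = inj₂ λ ()
  provable-or-falseP (a ∧p b) with provable-or-falseP a | provable-or-falseP b
  ... | inj₁ ⊢a | inj₁ ⊢b = inj₁ (∧RP ⊢a ⊢b)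
  ... | inj₂ fa | _       = inj₂ (fa ∘ ∧-elimˡ)
  ... | inj₁ _  | inj₂ fb = inj₂ (fb ∘ ∧-elimʳ)
  provable-or-falseP (a ∨p b) with provable-or-falseP a | provable-or-falseP b
  ... | inj₁ ⊢a | _       = inj₁ (cutP ⊢a (∨₁P a b))
  ... | inj₂ _  | inj₁ ⊢b = inj₁ (cutP ⊢b (∨₂P a b))
  ... | inj₂ fa | inj₂ fb = inj₂ (∨-elim fa fb)
  provable-or-falseP (◊p σ) = inj₂ λ ()

  true⇒≡⊤S : ∀ a → T (Null.evalS allFalse a) → a ≡S ⊤s
  true⇒≡⊤S a ta = ⊤S a , fromInj₁ (λ fa → ⊥-elim (fa ta)) (provable-or-falseS a)

  true⇒≡⊤P : ∀ a → T (Null.evalP allFalse a) → a ≡P ⊤p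
  true⇒≡⊤P a ta = ⊤P a , fromInj₁ (λ fa → ⊥-elim (fa ta)) (provable-or-falseP a)

  -- Parts (5) and (6): if π₁ ∨ π₂ ≡ ⊤, soundness makes one disjunct true
  -- under allFalse, and that disjunct is then ≡ ⊤.
  ⊤-join-primeP : ∀ π₁ π₂ → (π₁ ∨p π₂) ≡P ⊤p → π₁ ≡P ⊤p ⊎ π₂ ≡P ⊤p
  ⊤-join-primeP π₁ π₂ (_ , ⊤⊢π₁∨π₂) =
    [ inj₁ ∘ true⇒≡⊤P π₁ , inj₂ ∘ true⇒≡⊤P π₂ ]
      (Equivalence.to T-∨ (Null.soundP ⊤⊢π₁∨π₂ allFalse _))

  ⊤-join-primeS : ∀ σ₁ σ₂ → (σ₁ ∨s σ₂) ≡S ⊤s → σ₁ ≡S ⊤s ⊎ σ₂ ≡S ⊤s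
  ⊤-join-primeS σ₁ σ₂ (_ , ⊤⊢σ₁∨σ₂) =
    [ inj₁ ∘ true⇒≡⊤S σ₁ , inj₂ ∘ true⇒≡⊤S σ₂ ]
      (Equivalence.to T-∨ (Null.soundS ⊤⊢σ₁∨σ₂ allFalse _))

mainTheorem4 : (A : CompleteCRL) → FrameDistributive A → DuallyFrameDistributive A →
    (Prop : Set) → Prop ↣ ℕ →
    ((H : NormalHA) (f : BoundedLattice.Carrier (NormalHA.LP H) → CompleteCRL.D A) →
    IsAFilter A (NormalHA.LP H) f → IsAFilter A (NormalHA.LS H) (pre◇ A H f))
    × ((H : NormalHA) (g : BoundedLattice.Carrier (NormalHA.LS H) → CompleteCRL.D A) →
    IsAFilter A (NormalHA.LS H) g → IsAFilter A (NormalHA.LP H) (pre◊ A H g))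
    × ((f : LT.PP Prop → CompleteCRL.D A) →
    IsProperAFilter A (LT.PPLattice Prop) f →
    IsProperAFilter A (LT.SDLattice Prop) (pre◇ A (LT.LTAlgebra Prop) f))
    × ((g : LT.SD Prop → CompleteCRL.D A) →
    IsProperAFilter A (LT.SDLattice Prop) g →
    IsProperAFilter A (LT.PPLattice Prop) (pre◊ A (LT.LTAlgebra Prop) g))
    × ((π₁ π₂ : LT.PP Prop) →
    LT._≡P_ Prop (LT._∨p_ {Prop} π₁ π₂) (LT.⊤p {Prop}) →
    LT._≡P_ Prop π₁ (LT.⊤p {Prop}) ⊎ LT._≡P_ Prop π₂ (LT.⊤p {Prop}))
    × ((σ₁ σ₂ : LT.SD Prop) →
    LT._≡S_ Prop (LT._∨s_ {Prop} σ₁ σ₂) (LT.⊤s {Prop}) →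
    LT._≡S_ Prop σ₁ (LT.⊤s {Prop}) ⊎ LT._≡S_ Prop σ₂ (LT.⊤s {Prop}))
mainTheorem4 A FD _ Prop _ =
    (λ H → pre◇-isAFilter A FD H)
  , (λ H → pre◇-isAFilter A FD (converse H))
  , pre◇-isProper A FD LTAlgebra ◇-reflects-⊥
  , pre◇-isProper A FD (converse LTAlgebra) ◊-reflects-⊥
  , ⊤-join-primeP
  , ⊤-join-primeS
  where
  open LT Prop using (LTAlgebra)
  open Lindenbaum Prop
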